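{- For every connected split graph $G=(C\cup I,E)$ (with $C$ an inclusion-maximal clique and $I$ an independent set), $h(G)=pw(G)$.
   Context: Hunters and Rabbit game on a graph $G=(V,E)$. A hunter strategy is a finite sequence $(S_1,\dots,S_\ell)$ of non-empty subsets of $V$, using $\max_i|S_i|$ hunters. A rabbit trajectory is a walk $(r_0,\dots,r_\ell)$ in $G$ ($r_i\in N(r_{i-1})$); the strategy is winning if every rabbit trajectory has some $j<\ell$ with $r_j\in S_{j+1}$. The hunter number $h(G)$ is the minimum number of hunters of a winning hunter strategy ($0$ for a single-vertex graph). $pw(G)$ denotes the pathwidth of $G$. -}

module Defs where

open import Data.Nat using (ℕ; zero; suc; _≤_)
open import Data.Fin using (Fin; zero; suc; inject₁; fromℕ; _≤_)
open import Data.Fin.Subset using (Subset; _∈_; _∉_; _⊆_; ∣_∣; Nonempty)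
open import Data.Product using (Σ; ∃; _×_; _,_)
open import Data.Sum using (_⊎_)
open import Relation.Nullary using (¬_)
open import Relation.Binary.PropositionalEquality using (_≡_; _≢_)

record Graph : Set₁ where
  field
    n     : ℕ
    Adj   : Fin n → Fin n → Set
    sym   : ∀ {u v} → Adj u v → Adj v u
    irrefl : ∀ {u} → ¬ Adj u u
open Graph public

IsMin : (ℕ → Set) → ℕ → Set
IsMin P k = P k × (∀ m → P m → k Data.Nat.≤ m)

IsWalk : (G : Graph) (m : ℕ) → (Fin (suc m) → Fin (n G)) → Set
IsWalk G m w = ∀ (i : Fin m) → Adj G (w (inject₁ i)) (w (suc i))

Connected : Graph → Set
Connected G =
  (1 Data.Nat.≤ n G) ×
  (∀ (u v : Fin (n G)) →
     ∃ λ (m : ℕ) → ∃ λ (w : Fin (suc m) → Fin (n G)) →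
       IsWalk G m w × (w zero ≡ u) × (w (fromℕ m) ≡ v))

IsClique : (G : Graph) → Subset (n G) → Set
IsClique G C = ∀ {u v} → u ∈ C → v ∈ C → u ≢ v → Adj G u v

IsIndependent : (G : Graph) → Subset (n G) → Set
IsIndependent G I = ∀ {u v} → u ∈ I → v ∈ I → ¬ Adj G u v

IsMaximalClique : (G : Graph) → Subset (n G) → Set
IsMaximalClique G C =
  IsClique G C × (∀ (D : Subset (n G)) → IsClique G D → C ⊆ D → D ⊆ C)

IsSplitGraph : Graph → Set
IsSplitGraph G =
  ∃ λ (C : Subset (n G)) → ∃ λ (I : Subset (n G)) →
    (∀ v → v ∈ C ⊎ v ∈ I) × (∀ v → v ∈ C → v ∉ I) ×
    IsMaximalClique G C × IsIndependent G I

-- A hunter strategy (S_1,…,S_ℓ), 0-indexed: S i is S_{i+1}.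
record HunterStrategy (G : Graph) : Set where
  field
    len      : ℕ
    shot     : Fin len → Subset (n G)
    nonempty : ∀ i → Nonempty (shot i)
open HunterStrategy public

UsesAtMost : (G : Graph) → HunterStrategy G → ℕ → Set
UsesAtMost G S k = ∀ i → ∣ shot S i ∣ Data.Nat.≤ k

IsWinning : (G : Graph) → HunterStrategy G → Set
IsWinning G S =
  ∀ (r : Fin (suc (len S)) → Fin (n G)) → IsWalk G (len S) r →
    ∃ λ (j : Fin (len S)) → r (inject₁ j) ∈ shot S j

HasWinningWith : Graph → ℕ → Set
HasWinningWith G k = ∃ λ (S : HunterStrategy G) → IsWinning G S × UsesAtMost G S k

IsHunterNumber : Graph → ℕ → Set
IsHunterNumber G h =
  (n G ≡ 1 → h ≡ 0) × (n G ≢ 1 → IsMin (HasWinningWith G) h)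

record PathDecomposition (G : Graph) : Set where
  field
    len  : ℕ
    bag  : Fin len → Subset (n G)
    covers-vertices : ∀ v → ∃ λ i → v ∈ bag i
    covers-edges    : ∀ u v → Adj G u v → ∃ λ i → u ∈ bag i × v ∈ bag i
    contiguous      : ∀ v (i j k : Fin len) → i Data.Fin.≤ j → j Data.Fin.≤ k →
                        v ∈ bag i → v ∈ bag k → v ∈ bag j
open PathDecomposition public

-- width ≤ w, i.e. max_i |X_i| - 1 ≤ w.
HasPathDecompOfWidth : Graph → ℕ → Set
HasPathDecompOfWidth G w =
  ∃ λ (P : PathDecomposition G) → ∀ i → ∣ bag P i ∣ Data.Nat.≤ suc w

IsPathwidth : Graph → ℕ → Set
IsPathwidth G p = IsMin (HasPathDecompOfWidth G) p

-- Let k = |C| and call c₁, c₂ ∈ C (possibly equal) unlinked when no vertex of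
-- I is adjacent to both. Both h(G) and pw(G) equal k − 1 if an unlinked pair
-- exists and k otherwise.
--
-- Some bag contains the clique C (Helly property of the intervals
-- of a path decomposition), so pw ≥ k − 1. If all bags have at most k
-- vertices, that bag T meets no vertex of I; a clique vertex missing from the
-- last bag before T that meets I has no I-neighbour appearing before T, and
-- symmetrically after T, which yields an unlinked pair. Conversely, an
-- unlinked pair gives the decomposition with bags (C − c₁) + one I-vertex, then
-- C, then (C − c₂) + one I-vertex.
--
-- Shooting C twice always wins. Shooting C − c₁, C − c₂, C − c₂, C − c₁
-- wins for an unlinked pair: an unshot rabbit would pass through a common
-- I-neighbour of c₁ and c₂. Against fewer hunters a rabbit on a clique vertex r
-- either steps to an unshot clique vertex, or exactly C − r is shot; then the
-- hunters are at least k − 1, every pair is linked, and it detours through a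
-- common I-neighbour of r and a clique vertex unshot in the round after.
module Submission where

open import Defs
open import Data.Empty using (⊥; ⊥-elim)
open import Data.Fin as Fin using (Fin; zero; suc; toℕ; inject₁; fromℕ<; opposite; #_)
import Data.Fin.Properties as Finₚ
open import Data.Fin.Subset
  using (Subset; _∈_; _∉_; _⊆_; _⊈_; ∣_∣; _∪_; _─_; _-_; ⁅_⁆; Nonempty; inside; outside)
  renaming (⊥ to ∅)
open import Data.Fin.Subset.Properties
  using ( _∈?_; _⊆?_; nonempty?; ∣p∣≤n; ∣⊥∣≡0; p⊆q⇒∣p∣≤∣q∣; p⊂q⇒∣p∣<∣q∣; x∈p⇒∣p-x∣<∣p∣
        ; x∈p∧x≢y⇒x∈p-y; p─q⊆p; x∈p∪q⁺; x∈p∪q⁻; x∈⁅x⁆; x∈⁅y⁆⇒x≡y; ∪-identityʳ )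
open import Data.Nat as ℕ using (ℕ; zero; suc; pred; _+_; z≤n; s≤s)
import Data.Nat.Properties as ℕₚ
open import Data.Product using (∃; ∃₂; _×_; _,_; proj₁; proj₂)
open import Data.Sum using (_⊎_; inj₁; inj₂; [_,_]′)
open import Data.Vec using ([]; _∷_; here; there)
open import Function using (_∘_)
open import Relation.Nullary using (¬_; Dec; yes; no; does; contradiction)
open import Relation.Nullary.Decidable using (_×-dec_; _→-dec_; ¬?; decidable-stable; ¬¬-excluded-middle)
open import Relation.Binary.PropositionalEquality as ≡ using (_≡_; _≢_; refl; cong; subst; subst₂)

n≤1+pred[n] : ∀ m → m ℕ.≤ suc (pred m)
n≤1+pred[n] zero = z≤n
n≤1+pred[n] (suc m) = ℕₚ.≤-refl

squeeze : ∀ {a i j k} → a ≡ i → a ≡ k → i ℕ.≤ j → j ℕ.≤ k → a ≡ j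
squeeze refl refl a≤j j≤a = ℕₚ.≤-antisym a≤j j≤a

∣p∪⁅x⁆∣≤1+∣p∣ : ∀ {m} (p : Subset m) x → ∣ p ∪ ⁅ x ⁆ ∣ ℕ.≤ suc ∣ p ∣
∣p∪⁅x⁆∣≤1+∣p∣ (inside ∷ p) zero = s≤s (ℕₚ.m≤n⇒m≤1+n (ℕₚ.≤-reflexive (cong ∣_∣ (∪-identityʳ p))))
∣p∪⁅x⁆∣≤1+∣p∣ (outside ∷ p) zero = s≤s (ℕₚ.≤-reflexive (cong ∣_∣ (∪-identityʳ p)))
∣p∪⁅x⁆∣≤1+∣p∣ (inside ∷ p) (suc x) = s≤s (∣p∪⁅x⁆∣≤1+∣p∣ p x)
∣p∪⁅x⁆∣≤1+∣p∣ (outside ∷ p) (suc x) = ∣p∪⁅x⁆∣≤1+∣p∣ p x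

∣p-x∪⁅y⁆∣≤∣p∣ : ∀ {m} {p : Subset m} {x} y → x ∈ p → ∣ (p - x) ∪ ⁅ y ⁆ ∣ ℕ.≤ ∣ p ∣
∣p-x∪⁅y⁆∣≤∣p∣ {p = p} {x} y x∈p = ℕₚ.≤-trans (∣p∪⁅x⁆∣≤1+∣p∣ (p - x) y) (x∈p⇒∣p-x∣<∣p∣ x∈p)

∣p∣≤1+∣p-x∣ : ∀ {m} (p : Subset m) x → ∣ p ∣ ℕ.≤ suc ∣ p - x ∣
∣p∣≤1+∣p-x∣ p x = ℕₚ.≤-trans (p⊆q⇒∣p∣≤∣q∣ p⊆p-x∪x) (∣p∪⁅x⁆∣≤1+∣p∣ (p - x) x)
  where
  p⊆p-x∪x : p ⊆ (p - x) ∪ ⁅ x ⁆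
  p⊆p-x∪x {y} y∈p with y Finₚ.≟ x
  ... | yes refl = x∈p∪q⁺ (inj₂ (x∈⁅x⁆ x))
  ... | no y≢x = x∈p∪q⁺ (inj₁ (x∈p∧x≢y⇒x∈p-y y∈p y≢x))

x∈p─q⇒x∉q : ∀ {m} {p q : Subset m} {x} → x ∈ p ─ q → x ∉ q
x∈p─q⇒x∉q {p = _ ∷ _} {inside ∷ _} {zero} () here
x∈p─q⇒x∉q {p = _ ∷ _} {outside ∷ _} {zero} _ ()
x∈p─q⇒x∉q {p = _ ∷ _} {_ ∷ _} {suc _} (there x∈p─q) (there x∈q) = x∈p─q⇒x∉q x∈p─q x∈q

x∈p-y⇒x≢y : ∀ {m} {p : Subset m} {x y} → x ∈ p - y → x ≢ y
x∈p-y⇒x≢y {y = y} x∈p-y refl = x∈p─q⇒x∉q x∈p-y (x∈⁅x⁆ y)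

⊈-witness : ∀ {m} {p q : Subset m} → p ⊈ q → ∃ λ x → x ∈ p × x ∉ q
⊈-witness {p = p} {q} p⊈q with Finₚ.any? (λ x → (x ∈? p) ×-dec ¬? (x ∈? q))
... | yes witness = witness
... | no none = contradiction (λ {x} x∈p → decidable-stable (x ∈? q) λ x∉q → none (x , x∈p , x∉q)) p⊈q

⊆∧∣q∣≤∣p∣⇒q⊆p : ∀ {m} {p q : Subset m} → p ⊆ q → ∣ q ∣ ℕ.≤ ∣ p ∣ → q ⊆ p
⊆∧∣q∣≤∣p∣⇒q⊆p {p = p} p⊆q ∣q∣≤∣p∣ {x} x∈q =
  decidable-stable (x ∈? p) λ x∉p → ℕₚ.<⇒≱ (p⊂q⇒∣p∣<∣q∣ (p⊆q , x , x∈q , x∉p)) ∣q∣≤∣p∣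

x∈⁅y⁆∪⁅z⁆⁻ : ∀ {m} {x y z : Fin m} → x ∈ ⁅ y ⁆ ∪ ⁅ z ⁆ → x ≡ y ⊎ x ≡ z
x∈⁅y⁆∪⁅z⁆⁻ {y = y} {z} x∈ with x∈p∪q⁻ ⁅ y ⁆ ⁅ z ⁆ x∈
... | inj₁ x∈y = inj₁ (x∈⁅y⁆⇒x≡y y x∈y)
... | inj₂ x∈z = inj₂ (x∈⁅y⁆⇒x≡y z x∈z)

satisfying : ∀ {m} {P : Fin m → Set} → (∀ i → Dec (P i)) → Subset m
satisfying {zero} P? = []
satisfying {suc m} P? = does (P? zero) ∷ satisfying (P? ∘ suc)

∈-satisfying⁺ : ∀ {m} {P : Fin m → Set} (P? : ∀ i → Dec (P i)) {i} → P i → i ∈ satisfying P?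
∈-satisfying⁺ {suc m} P? {zero} p with P? zero
... | yes _ = here
... | no ¬p = contradiction p ¬p
∈-satisfying⁺ {suc m} P? {suc i} p = there (∈-satisfying⁺ (P? ∘ suc) p)

∈-satisfying⁻ : ∀ {m} {P : Fin m → Set} (P? : ∀ i → Dec (P i)) {i} → i ∈ satisfying P? → P i
∈-satisfying⁻ {suc m} P? {zero} zero∈ with P? zero | zero∈
... | yes p | _ = p
... | no _ | ()
∈-satisfying⁻ {suc m} P? {suc i} (there i∈) = ∈-satisfying⁻ (P? ∘ suc) i∈

∃-least : ∀ {m} {P : Fin m → Set} → (∀ i → Dec (P i)) → ∃ P →
          ∃ λ i → P i × (∀ j → P j → i Fin.≤ j)
∃-least {suc m} P? (i , pᵢ) with P? zero
... | yes p₀ = zero , p₀ , λ _ _ → z≤n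
... | no ¬p₀ with i
...   | zero = contradiction pᵢ ¬p₀
...   | suc i′ with ∃-least (P? ∘ suc) (i′ , pᵢ)
...     | l , pₗ , least = suc l , pₗ , λ { zero p₀ → contradiction p₀ ¬p₀ ; (suc j) pⱼ → s≤s (least j pⱼ) }

∃-greatest : ∀ {m} {P : Fin m → Set} → (∀ i → Dec (P i)) → ∃ P →
             ∃ λ i → P i × (∀ j → P j → j Fin.≤ i)
∃-greatest {suc m} P? (i , pᵢ) with Finₚ.any? (P? ∘ suc)
... | yes later with ∃-greatest (P? ∘ suc) later
...   | g , p_g , greatest = suc g , p_g , λ { zero _ → z≤n ; (suc j) pⱼ → s≤s (greatest j pⱼ) }
∃-greatest {suc m} P? (zero , p₀) | no none =
  zero , p₀ , λ { zero _ → z≤n ; (suc j) pⱼ → contradiction (j , pⱼ) none }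
∃-greatest {suc m} P? (suc i , pᵢ) | no none = contradiction (i , pᵢ) none

opposite-≤ : ∀ {m} {i j : Fin m} → i Fin.≤ j → opposite j Fin.≤ opposite i
opposite-≤ {m} {i} {j} i≤j =
  subst₂ ℕ._≤_ (≡.sym (Finₚ.opposite-prop j)) (≡.sym (Finₚ.opposite-prop i)) (ℕₚ.∸-monoʳ-≤ m (s≤s i≤j))

¬¬-∀ : ∀ {m} {P : Fin m → Set} → (∀ i → ¬ ¬ P i) → ¬ ¬ (∀ i → P i)
¬¬-∀ {zero} _ ¬∀ = ¬∀ λ ()
¬¬-∀ {suc m} {P} ¬¬P ¬∀ =
  ¬¬P zero λ p₀ → ¬¬-∀ {P = P ∘ suc} (¬¬P ∘ suc) λ p → ¬∀ λ { zero → p₀ ; (suc i) → p i }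

¬¬-decidable : ∀ {m} (R : Fin m → Fin m → Set) → ¬ ¬ (∀ u v → Dec (R u v))
¬¬-decidable R = ¬¬-∀ λ u → ¬¬-∀ λ v → ¬¬-excluded-middle

edge⇒n≢1 : ∀ {G : Graph} {u v} → Adj G u v → n G ≢ 1
edge⇒n≢1 {G} {u} {v} u~v n≡1 = irrefl G (subst (Adj G u) (≡.sym u≡v) u~v)
  where
  toℕ≡0 : ∀ (w : Fin (n G)) → toℕ w ≡ 0
  toℕ≡0 w = ℕₚ.n<1⇒n≡0 (subst (toℕ w ℕ.<_) n≡1 (Finₚ.toℕ<n w))
  u≡v : u ≡ v
  u≡v = Finₚ.toℕ-injective (≡.trans (toℕ≡0 u) (≡.sym (toℕ≡0 v)))

connected⇒edge : ∀ {G : Graph} → Connected G → n G ≢ 1 → ∃₂ (Adj G)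
connected⇒edge {G} (1≤n , walk-between) n≢1 = first-step (walk-between v₀ v₁)
  where
  2≤n : 2 ℕ.≤ n G
  2≤n = ℕₚ.≤∧≢⇒< 1≤n (n≢1 ∘ ≡.sym)
  v₀ v₁ : Fin (n G)
  v₀ = fromℕ< 1≤n
  v₁ = fromℕ< 2≤n
  v₀≢v₁ : v₀ ≢ v₁
  v₀≢v₁ v₀≡v₁ with ≡.trans (≡.sym (Finₚ.toℕ-fromℕ< 1≤n)) (≡.trans (cong toℕ v₀≡v₁) (Finₚ.toℕ-fromℕ< 2≤n))
  ... | ()
  first-step : (∃ λ m → ∃ λ w → IsWalk G m w × w zero ≡ v₀ × w (Fin.fromℕ m) ≡ v₁) → ∃₂ (Adj G)
  first-step (zero , w , _ , w₀≡v₀ , w₀≡v₁) = contradiction (≡.trans (≡.sym w₀≡v₀) w₀≡v₁) v₀≢v₁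
  first-step (suc m , w , walk , _ , _) = _ , _ , walk zero

edge-clique : ∀ {G : Graph} {x y} → Adj G x y → IsClique G (⁅ x ⁆ ∪ ⁅ y ⁆)
edge-clique {G} x~y u∈ v∈ u≢v with x∈⁅y⁆∪⁅z⁆⁻ u∈ | x∈⁅y⁆∪⁅z⁆⁻ v∈
... | inj₁ refl | inj₁ refl = contradiction refl u≢v
... | inj₁ refl | inj₂ refl = x~y
... | inj₂ refl | inj₁ refl = sym G x~y
... | inj₂ refl | inj₂ refl = contradiction refl u≢v

IsWalk-toℕ : ∀ {G : Graph} {ℓ} (f : ℕ → Fin (n G)) →
             (∀ i → i ℕ.< ℓ → Adj G (f i) (f (suc i))) → IsWalk G ℓ (f ∘ toℕ)
IsWalk-toℕ {G} f steps i =
  subst (λ s → Adj G (f s) (f (suc (toℕ i)))) (≡.sym (Finₚ.toℕ-inject₁ i)) (steps (toℕ i) (Finₚ.toℕ<n i))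

module _ {G : Graph} (D : PathDecomposition G) where

  firstBag : ∀ v → ∃ λ i → v ∈ bag D i × (∀ j → v ∈ bag D j → i Fin.≤ j)
  firstBag v = ∃-least (λ i → v ∈? bag D i) (covers-vertices D v)

  StartsAt : Subset (n G) → Fin (PathDecomposition.len D) → Set
  StartsAt K i = ∃ λ c → c ∈ K × c ∈ bag D i × (∀ j → c ∈ bag D j → i Fin.≤ j)

  startsAt? : ∀ K i → Dec (StartsAt K i)
  startsAt? K i = Finₚ.any? λ c →
    (c ∈? K) ×-dec ((c ∈? bag D i) ×-dec Finₚ.all? λ j → (c ∈? bag D j) →-dec (i Fin.≤? j))

  -- Take the bag where the last-starting vertex c′ of K first appears: every
  -- other vertex of K has started by then and meets c′ in a later bag.
  clique⊆bag : ∀ {K} → IsClique G K → Nonempty K → ∃ λ t → K ⊆ bag D t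
  clique⊆bag {K} K-clique (c₀ , c₀∈K) with firstBag c₀
  ... | i₀ , c₀∈i₀ , i₀-first with ∃-greatest (startsAt? K) (i₀ , c₀ , c₀∈K , c₀∈i₀ , i₀-first)
  ... | t , (c′ , c′∈K , c′∈t , t-first) , t-last = t , K⊆t
    where
    K⊆t : K ⊆ bag D t
    K⊆t {c} c∈K with c Finₚ.≟ c′
    ... | yes refl = c′∈t
    ... | no c≢c′ with covers-edges D c c′ (K-clique c∈K c′∈K c≢c′) | firstBag c
    ... | e , c∈e , c′∈e | a , c∈a , a-first =
      contiguous D c a t e (t-last a (c , c∈K , c∈a , a-first)) (t-first e c′∈e) c∈a c∈e

  ∈-opposite² : ∀ {v i} → v ∈ bag D i → v ∈ bag D (opposite (opposite i))
  ∈-opposite² {v} {i} = subst (λ j → v ∈ bag D j) (≡.sym (Finₚ.opposite-involutive i))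

  reverse : PathDecomposition G
  reverse = record
    { len = PathDecomposition.len D
    ; bag = bag D ∘ opposite
    ; covers-vertices = λ v → let (i , v∈i) = covers-vertices D v in opposite i , ∈-opposite² v∈i
    ; covers-edges = λ u v u~v → let (i , u∈i , v∈i) = covers-edges D u v u~v in
        opposite i , ∈-opposite² u∈i , ∈-opposite² v∈i
    ; contiguous = λ v i j k i≤j j≤k v∈i v∈k →
        contiguous D v (opposite k) (opposite j) (opposite i) (opposite-≤ j≤k) (opposite-≤ i≤j) v∈k v∈i
    }

occurrenceDecomposition :
  ∀ {G : Graph} (len : ℕ) {Occurs : Fin (n G) → ℕ → Set} → (∀ v t → Dec (Occurs v t)) →
  (∀ v → ∃ λ t → t ℕ.< len × Occurs v t) →
  (∀ u v → Adj G u v → ∃ λ t → t ℕ.< len × Occurs u t × Occurs v t) →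
  (∀ v {i j k} → i ℕ.≤ j → j ℕ.≤ k → Occurs v i → Occurs v k → Occurs v j) →
  PathDecomposition G
occurrenceDecomposition {G} len {Occurs} occurs? vertices edges convex = record
  { len = len
  ; bag = bagAt
  ; covers-vertices = λ v → let (t , t<len , occ) = vertices v in fromℕ< t<len , ∈bag t<len occ
  ; covers-edges = λ u v u~v → let (t , t<len , occᵤ , occᵥ) = edges u v u~v in
      fromℕ< t<len , ∈bag t<len occᵤ , ∈bag t<len occᵥ
  ; contiguous = λ v i j k i≤j j≤k v∈i v∈k →
      ∈-satisfying⁺ (λ w → occurs? w (toℕ j))
        (convex v i≤j j≤k (∈-satisfying⁻ (λ w → occurs? w (toℕ i)) v∈i) (∈-satisfying⁻ (λ w → occurs? w (toℕ k)) v∈k))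
  }
  where
  bagAt : Fin len → Subset (n G)
  bagAt j = satisfying λ w → occurs? w (toℕ j)
  ∈bag : ∀ {v t} (t<len : t ℕ.< len) → Occurs v t → v ∈ bagAt (fromℕ< t<len)
  ∈bag {v} t<len occ =
    ∈-satisfying⁺ (λ w → occurs? w (toℕ (fromℕ< t<len))) (subst (Occurs v) (≡.sym (Finₚ.toℕ-fromℕ< t<len)) occ)

module _ {G : Graph} (S : HunterStrategy G) where

  -- The shot of round t (S_{t+1}), padded with empty shots after the last round.
  shotAt : ℕ → Subset (n G)
  shotAt t with t ℕ.<? HunterStrategy.len S
  ... | yes t<ℓ = shot S (fromℕ< t<ℓ)
  ... | no _ = ∅

  shotAt-toℕ : ∀ i → shotAt (toℕ i) ≡ shot S i
  shotAt-toℕ i with toℕ i ℕ.<? HunterStrategy.len S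
  ... | yes i<ℓ = cong (shot S) (Finₚ.fromℕ<-toℕ i i<ℓ)
  ... | no i≮ℓ = contradiction (Finₚ.toℕ<n i) i≮ℓ

  ∣shotAt∣≤ : ∀ {m} → UsesAtMost G S m → ∀ t → ∣ shotAt t ∣ ℕ.≤ m
  ∣shotAt∣≤ {m} uses t with t ℕ.<? HunterStrategy.len S
  ... | yes t<ℓ = uses (fromℕ< t<ℓ)
  ... | no _ = subst (ℕ._≤ m) (≡.sym (∣⊥∣≡0 (n G))) z≤n

  EscapesFrom : ℕ → ℕ → Fin (n G) → Set
  EscapesFrom d t r =
    ∃ λ (f : ℕ → Fin (n G)) → f 0 ≡ r ×
      (∀ i → i ℕ.< d → Adj G (f i) (f (suc i))) × (∀ i → i ℕ.< d → f i ∉ shotAt (t + i))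

  escapes-step : ∀ {d t r r′} → Adj G r r′ → r ∉ shotAt t → EscapesFrom d (suc t) r′ → EscapesFrom (suc d) t r
  escapes-step {d} {t} {r} r~r′ r∉ (f , refl , steps , safe) = g , refl , steps′ , safe′
    where
    g : ℕ → Fin (n G)
    g zero = r
    g (suc i) = f i
    steps′ : ∀ i → i ℕ.< suc d → Adj G (g i) (g (suc i))
    steps′ zero _ = r~r′
    steps′ (suc i) (s≤s i<d) = steps i i<d
    safe′ : ∀ i → i ℕ.< suc d → g i ∉ shotAt (t + i)
    safe′ zero _ = subst (λ s → r ∉ shotAt s) (≡.sym (ℕₚ.+-identityʳ t)) r∉
    safe′ (suc i) (s≤s i<d) = subst (λ s → f i ∉ shotAt s) (≡.sym (ℕₚ.+-suc t i)) (safe i i<d)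

  escapes-weaken : ∀ {d t r} → EscapesFrom (suc d) t r → EscapesFrom d t r
  escapes-weaken (f , f₀ , steps , safe) =
    f , f₀ , (λ i i<d → steps i (ℕₚ.m<n⇒m<1+n i<d)) , (λ i i<d → safe i (ℕₚ.m<n⇒m<1+n i<d))

  escapes⇒¬winning : ∀ {r} → EscapesFrom (HunterStrategy.len S) 0 r → ¬ IsWinning G S
  escapes⇒¬winning (f , _ , steps , safe) wins =
    let (j , hit) = wins (f ∘ toℕ) (IsWalk-toℕ {G} f steps) in
    safe (toℕ j) (Finₚ.toℕ<n j)
      (subst (f (toℕ j) ∈_) (≡.sym (shotAt-toℕ j)) (subst (λ s → f s ∈ shot S j) (Finₚ.toℕ-inject₁ j) hit))

module SplitGraph
  (G : Graph) (adj? : ∀ u v → Dec (Adj G u v)) (C I : Subset (n G))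
  (C∪I : ∀ v → v ∈ C ⊎ v ∈ I) (C∩I : ∀ v → v ∈ C → v ∉ I)
  (clique : IsClique G C) (maximal : ∀ D → IsClique G D → C ⊆ D → D ⊆ C)
  (independent : IsIndependent G I)
  where

  V : Set
  V = Fin (n G)

  k : ℕ
  k = ∣ C ∣

  ∈I⇒∉C : ∀ {v} → v ∈ I → v ∉ C
  ∈I⇒∉C {v} v∈I v∈C = C∩I v v∈C v∈I

  ∉C⇒∈I : ∀ {v} → v ∉ C → v ∈ I
  ∉C⇒∈I {v} v∉C with C∪I v
  ... | inj₁ v∈C = contradiction v∈C v∉C
  ... | inj₂ v∈I = v∈I

  I-neighbour∈C : ∀ {u v} → u ∈ I → Adj G u v → v ∈ C
  I-neighbour∈C {u} {v} u∈I u~v with C∪I v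
  ... | inj₁ v∈C = v∈C
  ... | inj₂ v∈I = contradiction u~v (independent u∈I v∈I)

  C-nonempty : 1 ℕ.≤ n G → Nonempty C
  C-nonempty 1≤n with nonempty? C
  ... | yes C≢∅ = C≢∅
  ... | no C≡∅ = v , maximal ⁅ v ⁆ singleton-clique (λ c∈C → contradiction (_ , c∈C) C≡∅) (x∈⁅x⁆ v)
    where
    v : V
    v = fromℕ< 1≤n
    singleton-clique : IsClique G ⁅ v ⁆
    singleton-clique u∈ w∈ u≢w = contradiction (≡.trans (x∈⁅y⁆⇒x≡y v u∈) (≡.sym (x∈⁅y⁆⇒x≡y v w∈))) u≢w

  TwoInC : Set
  TwoInC = ∃₂ λ a b → a ∈ C × b ∈ C × a ≢ b

  -- If C were {x}, maximality would add the I-neighbour y of x to C.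
  clique-end⇒two-in-C : ∀ {x y} → x ∈ C → Adj G x y → TwoInC
  clique-end⇒two-in-C {x} {y} x∈C x~y with C∪I y | C ⊆? ⁅ x ⁆
  ... | inj₁ y∈C | _ = x , y , x∈C , y∈C , λ x≡y → irrefl G (subst (Adj G x) (≡.sym x≡y) x~y)
  ... | inj₂ y∈I | no C⊈x =
    let (c , c∈C , c∉x) = ⊈-witness C⊈x in c , x , c∈C , x∈C , λ c≡x → c∉x (subst (_∈ ⁅ x ⁆) (≡.sym c≡x) (x∈⁅x⁆ x))
  ... | inj₂ y∈I | yes C⊆x =
    contradiction (maximal _ (edge-clique {G} x~y) (λ c∈C → x∈p∪q⁺ (inj₁ (C⊆x c∈C))) (x∈p∪q⁺ (inj₂ (x∈⁅x⁆ y)))) (∈I⇒∉C y∈I)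

  edge⇒two-in-C : ∀ {x y} → Adj G x y → TwoInC
  edge⇒two-in-C {x} x~y with C∪I x
  ... | inj₁ x∈C = clique-end⇒two-in-C x∈C x~y
  ... | inj₂ x∈I = clique-end⇒two-in-C (I-neighbour∈C x∈I x~y) (sym G x~y)

  Unlinked : V → V → Set
  Unlinked c₁ c₂ = ∀ v → v ∈ I → ¬ (Adj G v c₁ × Adj G v c₂)

  HasUnlinkedPair : Set
  HasUnlinkedPair = ∃₂ λ c₁ c₂ → c₁ ∈ C × c₂ ∈ C × Unlinked c₁ c₂

  unlinked? : Dec HasUnlinkedPair
  unlinked? = Finₚ.any? λ c₁ → Finₚ.any? λ c₂ → (c₁ ∈? C) ×-dec ((c₂ ∈? C) ×-dec
    Finₚ.all? λ v → (v ∈? I) →-dec ¬? (adj? v c₁ ×-dec adj? v c₂))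

  common-I-neighbour : ¬ HasUnlinkedPair → ∀ {c₁ c₂} → c₁ ∈ C → c₂ ∈ C →
                       ∃ λ w → w ∈ I × Adj G c₁ w × Adj G w c₂
  common-I-neighbour all-linked {c₁} {c₂} c₁∈C c₂∈C
    with Finₚ.any? (λ w → (w ∈? I) ×-dec (adj? c₁ w ×-dec adj? w c₂))
  ... | yes common = common
  ... | no none = contradiction
    (c₁ , c₂ , c₁∈C , c₂∈C , λ w w∈I (w~c₁ , w~c₂) → none (w , w∈I , sym G w~c₁ , w~c₂)) all-linked

  pred-k≤width : ∀ {c₀ w} → c₀ ∈ C → HasPathDecompOfWidth G w → pred k ℕ.≤ w
  pred-k≤width c₀∈C (D , width) with clique⊆bag D clique (_ , c₀∈C)
  ... | T , C⊆T = ℕₚ.pred-mono-≤ (ℕₚ.≤-trans (p⊆q⇒∣p∣≤∣q∣ C⊆T) (width T))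

  module _ (D : PathDecomposition G) (narrow : ∀ i → ∣ bag D i ∣ ℕ.≤ k) where

    I∉bag⊇C : ∀ {t v} → C ⊆ bag D t → v ∈ I → v ∉ bag D t
    I∉bag⊇C {t} C⊆t v∈I v∈t = ∈I⇒∉C v∈I (⊆∧∣q∣≤∣p∣⇒q⊆p C⊆t (narrow t) v∈t)

    -- c is missing from the last bag s before T that meets I.
    unlinked-before : ∀ {c₀ T} → c₀ ∈ C → C ⊆ bag D T →
      ∃ λ c → c ∈ C × (∀ {v o} → v ∈ I → o Fin.≤ T → v ∈ bag D o → ¬ Adj G v c)
    unlinked-before {c₀} {T} c₀∈C C⊆T
      with Finₚ.any? (λ i → (i Fin.≤? T) ×-dec Finₚ.any? λ v → (v ∈? I) ×-dec (v ∈? bag D i))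
    ... | no none = c₀ , c₀∈C , λ v∈I o≤T v∈o _ → none (_ , o≤T , _ , v∈I , v∈o)
    ... | yes some
      with ∃-greatest (λ i → (i Fin.≤? T) ×-dec Finₚ.any? λ v → (v ∈? I) ×-dec (v ∈? bag D i)) some
    ... | s , (s≤T , w , w∈I , w∈s) , s-last with C ⊆? bag D s
    ...   | yes C⊆s = contradiction w∈s (I∉bag⊇C C⊆s w∈I)
    ...   | no C⊈s with ⊈-witness C⊈s
    ...     | c , c∈C , c∉s = c , c∈C , never
      where
      never : ∀ {v o} → v ∈ I → o Fin.≤ T → v ∈ bag D o → ¬ Adj G v c
      never {v} {o} v∈I o≤T v∈o v~c with covers-edges D v c v~c
      ... | e , v∈e , c∈e with e Fin.≤? T
      ... | yes e≤T = c∉s (contiguous D c e s T (s-last e (e≤T , v , v∈I , v∈e)) s≤T c∈e (C⊆T c∈C))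
      ... | no e≰T = I∉bag⊇C C⊆T v∈I (contiguous D v o T e o≤T (ℕₚ.≰⇒≥ e≰T) v∈o v∈e)

  narrow⇒unlinked : ∀ {c₀} → c₀ ∈ C → (D : PathDecomposition G) → (∀ i → ∣ bag D i ∣ ℕ.≤ k) → HasUnlinkedPair
  narrow⇒unlinked c₀∈C D narrow with clique⊆bag D clique (_ , c₀∈C)
  ... | T , C⊆T
    with unlinked-before D narrow c₀∈C C⊆T
       | unlinked-before (reverse D) (narrow ∘ opposite) c₀∈C (λ c∈C → ∈-opposite² D (C⊆T c∈C))
  ... | c₁ , c₁∈C , before | c₂ , c₂∈C , after = c₁ , c₂ , c₁∈C , c₂∈C , unlinked
    where
    unlinked : Unlinked c₁ c₂
    unlinked v v∈I (v~c₁ , v~c₂) =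
      let (o , v∈o) = covers-vertices D v in
      [ (λ o≤T → before v∈I o≤T v∈o v~c₁)
      , (λ T≤o → after v∈I (opposite-≤ T≤o) (∈-opposite² D v∈o) v~c₂)
      ]′ (Finₚ.≤-total o T)

  module WideDecomposition where

    Occurs : V → ℕ → Set
    Occurs v t = v ∈ I → toℕ v ≡ t

    occurs? : ∀ v t → Dec (Occurs v t)
    occurs? v t = (v ∈? I) →-dec (toℕ v ℕ.≟ t)

    edges : ∀ u v → Adj G u v → ∃ λ t → t ℕ.< n G × Occurs u t × Occurs v t
    edges u v u~v with C∪I u
    ... | inj₁ u∈C = toℕ v , Finₚ.toℕ<n v , (λ u∈I → contradiction u∈C (∈I⇒∉C u∈I)) , (λ _ → refl)
    ... | inj₂ u∈I = toℕ u , Finₚ.toℕ<n u , (λ _ → refl) , (λ v∈I → contradiction u~v (independent u∈I v∈I))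

    decomposition : PathDecomposition G
    decomposition = occurrenceDecomposition (n G) occurs?
      (λ v → toℕ v , Finₚ.toℕ<n v , λ _ → refl)
      edges
      (λ v i≤j j≤k occᵢ occₖ v∈I → squeeze (occᵢ v∈I) (occₖ v∈I) i≤j j≤k)

    width : ∀ j → ∣ bag decomposition j ∣ ℕ.≤ suc k
    width j = ℕₚ.≤-trans (p⊆q⇒∣p∣≤∣q∣ bag⊆C+j) (∣p∪⁅x⁆∣≤1+∣p∣ C j)
      where
      bag⊆C+j : bag decomposition j ⊆ C ∪ ⁅ j ⁆
      bag⊆C+j {u} u∈j with C∪I u
      ... | inj₁ u∈C = x∈p∪q⁺ (inj₁ u∈C)
      ... | inj₂ u∈I = x∈p∪q⁺ (inj₂ (subst (_∈ ⁅ j ⁆) (≡.sym u≡j) (x∈⁅x⁆ j)))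
        where
        u≡j : u ≡ j
        u≡j = Finₚ.toℕ-injective (∈-satisfying⁻ (λ w → occurs? w (toℕ j)) u∈j u∈I)

  wideDecomposition : HasPathDecompOfWidth G k
  wideDecomposition = WideDecomposition.decomposition , WideDecomposition.width

  module NarrowDecomposition {c₁ c₂} (c₁∈C : c₁ ∈ C) (c₂∈C : c₂ ∈ C) (unlinked : Unlinked c₁ c₂) where

    N : ℕ
    N = n G

    -- Bags are indexed by 0, …, 2N. An I-vertex v occupies the single bag
    -- slot v, left of N if v is not adjacent to c₁ and right of N otherwise;
    -- c₁ occurs only from N on and c₂ only up to N.
    slot : V → ℕ
    slot v with adj? v c₁
    ... | yes _ = suc (N + toℕ v)
    ... | no _ = toℕ v

    N<slot : ∀ {v} → Adj G v c₁ → N ℕ.< slot v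
    N<slot {v} v~c₁ with adj? v c₁
    ... | yes _ = s≤s (ℕₚ.m≤m+n N (toℕ v))
    ... | no v≁c₁ = contradiction v~c₁ v≁c₁

    slot<N : ∀ {v} → ¬ Adj G v c₁ → slot v ℕ.< N
    slot<N {v} v≁c₁ with adj? v c₁
    ... | yes v~c₁ = contradiction v~c₁ v≁c₁
    ... | no _ = Finₚ.toℕ<n v

    slot<2N+1 : ∀ v → slot v ℕ.< N + suc N
    slot<2N+1 v with adj? v c₁
    ... | yes _ = subst (suc (suc (N + toℕ v)) ℕ.≤_) (≡.sym (ℕₚ.+-suc N N)) (s≤s (ℕₚ.+-monoʳ-< N (Finₚ.toℕ<n v)))
    ... | no _ = ℕₚ.<-≤-trans (Finₚ.toℕ<n v) (ℕₚ.m≤m+n N (suc N))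

    slot-injective : ∀ {u v} → slot u ≡ slot v → u ≡ v
    slot-injective {u} {v} eq with adj? u c₁ | adj? v c₁
    ... | yes _ | yes _ = Finₚ.toℕ-injective (ℕₚ.+-cancelˡ-≡ N _ _ (ℕₚ.suc-injective eq))
    ... | no _ | no _ = Finₚ.toℕ-injective eq
    ... | yes _ | no _ =
      contradiction (subst (N ℕ.≤_) eq (ℕₚ.m≤n⇒m≤1+n (ℕₚ.m≤m+n N (toℕ u)))) (ℕₚ.<⇒≱ (Finₚ.toℕ<n v))
    ... | no _ | yes _ =
      contradiction (subst (N ℕ.≤_) (≡.sym eq) (ℕₚ.m≤n⇒m≤1+n (ℕₚ.m≤m+n N (toℕ v)))) (ℕₚ.<⇒≱ (Finₚ.toℕ<n u))

    Occurs : V → ℕ → Set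
    Occurs v t = (v ∈ C → (v ≡ c₁ → N ℕ.≤ t) × (v ≡ c₂ → t ℕ.≤ N)) × (v ∈ I → slot v ≡ t)

    occurs? : ∀ v t → Dec (Occurs v t)
    occurs? v t =
      ((v ∈? C) →-dec (((v Finₚ.≟ c₁) →-dec (N ℕ.≤? t)) ×-dec ((v Finₚ.≟ c₂) →-dec (t ℕ.≤? N))))
      ×-dec ((v ∈? I) →-dec (slot v ℕ.≟ t))

    C-at-N : ∀ {v} → v ∈ C → Occurs v N
    C-at-N v∈C = (λ _ → (λ _ → ℕₚ.≤-refl) , (λ _ → ℕₚ.≤-refl)) , λ v∈I → contradiction v∈C (∈I⇒∉C v∈I)

    I-at-slot : ∀ {v} → v ∈ I → Occurs v (slot v)
    I-at-slot v∈I = (λ v∈C → contradiction v∈C (∈I⇒∉C v∈I)) , λ _ → refl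

    neighbour-at-slot : ∀ {c w} → c ∈ C → w ∈ I → Adj G w c → Occurs c (slot w)
    neighbour-at-slot {c} {w} c∈C w∈I w~c = (λ _ → after-c₁ , before-c₂) , λ c∈I → contradiction c∈C (∈I⇒∉C c∈I)
      where
      after-c₁ : c ≡ c₁ → N ℕ.≤ slot w
      after-c₁ c≡c₁ = ℕₚ.<⇒≤ (N<slot (subst (Adj G w) c≡c₁ w~c))
      before-c₂ : c ≡ c₂ → slot w ℕ.≤ N
      before-c₂ c≡c₂ = ℕₚ.<⇒≤ (slot<N λ w~c₁ → unlinked w w∈I (w~c₁ , subst (Adj G w) c≡c₂ w~c))

    vertices : ∀ v → ∃ λ t → t ℕ.< N + suc N × Occurs v t
    vertices v with C∪I v
    ... | inj₁ v∈C = N , ℕₚ.m<m+n N (s≤s z≤n) , C-at-N v∈C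
    ... | inj₂ v∈I = slot v , slot<2N+1 v , I-at-slot v∈I

    edges : ∀ u v → Adj G u v → ∃ λ t → t ℕ.< N + suc N × Occurs u t × Occurs v t
    edges u v u~v with C∪I u | C∪I v
    ... | inj₁ u∈C | inj₁ v∈C = N , ℕₚ.m<m+n N (s≤s z≤n) , C-at-N u∈C , C-at-N v∈C
    ... | inj₁ u∈C | inj₂ v∈I = slot v , slot<2N+1 v , neighbour-at-slot u∈C v∈I (sym G u~v) , I-at-slot v∈I
    ... | inj₂ u∈I | inj₁ v∈C = slot u , slot<2N+1 u , I-at-slot u∈I , neighbour-at-slot v∈C u∈I u~v
    ... | inj₂ u∈I | inj₂ v∈I = contradiction u~v (independent u∈I v∈I)

    convex : ∀ v {i j k} → i ℕ.≤ j → j ℕ.≤ k → Occurs v i → Occurs v k → Occurs v j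
    convex v i≤j j≤k (Cᵢ , Iᵢ) (Cₖ , Iₖ) =
      (λ v∈C → (λ v≡c₁ → ℕₚ.≤-trans (proj₁ (Cᵢ v∈C) v≡c₁) i≤j) , (λ v≡c₂ → ℕₚ.≤-trans j≤k (proj₂ (Cₖ v∈C) v≡c₂))) ,
      λ v∈I → squeeze (Iᵢ v∈I) (Iₖ v∈I) i≤j j≤k

    decomposition : PathDecomposition G
    decomposition = occurrenceDecomposition (N + suc N) occurs? vertices edges convex

    occurs : ∀ {v j} → v ∈ bag decomposition j → Occurs v (toℕ j)
    occurs {j = j} = ∈-satisfying⁻ (λ w → occurs? w (toℕ j))

    -- A bag meeting I on the left misses c₁, on the right it misses c₂.
    missing : ∀ {x j} → x ∈ I → x ∈ bag decomposition j → ∃ λ c → c ∈ C × c ∉ bag decomposition j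
    missing {x} {j} x∈I x∈j with adj? x c₁
    ... | yes x~c₁ = c₂ , c₂∈C , λ c₂∈j →
      ℕₚ.<⇒≱ (subst (N ℕ.<_) (proj₂ (occurs x∈j) x∈I) (N<slot x~c₁)) (proj₂ (proj₁ (occurs c₂∈j) c₂∈C) refl)
    ... | no x≁c₁ = c₁ , c₁∈C , λ c₁∈j →
      ℕₚ.<⇒≱ (subst (ℕ._< N) (proj₂ (occurs x∈j) x∈I) (slot<N x≁c₁)) (proj₁ (proj₁ (occurs c₁∈j) c₁∈C) refl)

    bag≤k : ∀ j → ∣ bag decomposition j ∣ ℕ.≤ k
    bag≤k j with Finₚ.any? (λ x → (x ∈? I) ×-dec (x ∈? bag decomposition j))
    ... | no none = p⊆q⇒∣p∣≤∣q∣ λ {u} u∈j → decidable-stable (u ∈? C) λ u∉C → none (u , ∉C⇒∈I u∉C , u∈j)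
    ... | yes (x , x∈I , x∈j) with missing x∈I x∈j
    ...   | c , c∈C , c∉j = ℕₚ.≤-trans (p⊆q⇒∣p∣≤∣q∣ bag⊆C-c+x) (∣p-x∪⁅y⁆∣≤∣p∣ x c∈C)
      where
      bag⊆C-c+x : bag decomposition j ⊆ (C - c) ∪ ⁅ x ⁆
      bag⊆C-c+x {u} u∈j with C∪I u
      ... | inj₁ u∈C = x∈p∪q⁺ (inj₁ (x∈p∧x≢y⇒x∈p-y u∈C λ u≡c → c∉j (subst (_∈ bag decomposition j) u≡c u∈j)))
      ... | inj₂ u∈I = x∈p∪q⁺ (inj₂ (subst (_∈ ⁅ x ⁆) (≡.sym u≡x) (x∈⁅x⁆ x)))
        where
        u≡x : u ≡ x
        u≡x = slot-injective (≡.trans (proj₂ (occurs u∈j) u∈I) (≡.sym (proj₂ (occurs x∈j) x∈I)))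

  narrowDecomposition : HasUnlinkedPair → HasPathDecompOfWidth G (pred k)
  narrowDecomposition (_ , _ , c₁∈C , c₂∈C , unlinked) =
    decomposition , λ j → ℕₚ.≤-trans (bag≤k j) (n≤1+pred[n] k)
    where open NarrowDecomposition c₁∈C c₂∈C unlinked

  wideStrategy : ∀ {c₀} → c₀ ∈ C → HasWinningWith G k
  wideStrategy c₀∈C = strategy , wins , λ _ → ℕₚ.≤-refl
    where
    strategy : HunterStrategy G
    strategy = record { len = 2 ; shot = λ _ → C ; nonempty = λ _ → _ , c₀∈C }
    wins : IsWinning G strategy
    wins r steps with C∪I (r (# 0)) | C∪I (r (# 1))
    ... | inj₁ r₀∈C | _ = # 0 , r₀∈C
    ... | inj₂ _ | inj₁ r₁∈C = # 1 , r₁∈C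
    ... | inj₂ r₀∈I | inj₂ r₁∈I = contradiction (steps (# 0)) (independent r₀∈I r₁∈I)

  C-minus-nonempty : TwoInC → ∀ c → Nonempty (C - c)
  C-minus-nonempty (a , b , a∈C , b∈C , a≢b) c with a Finₚ.≟ c
  ... | yes a≡c = b , x∈p∧x≢y⇒x∈p-y b∈C (λ b≡c → a≢b (≡.trans a≡c (≡.sym b≡c)))
  ... | no a≢c = a , x∈p∧x≢y⇒x∈p-y a∈C a≢c

  module Sweep {c₁ c₂} (c₁∈C : c₁ ∈ C) (c₂∈C : c₂ ∈ C) (unlinked : Unlinked c₁ c₂) (two : TwoInC) where

    spared : Fin 4 → V
    spared zero = c₁
    spared (suc zero) = c₂
    spared (suc (suc zero)) = c₂
    spared (suc (suc (suc zero))) = c₁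

    spared∈C : ∀ i → spared i ∈ C
    spared∈C zero = c₁∈C
    spared∈C (suc zero) = c₂∈C
    spared∈C (suc (suc zero)) = c₂∈C
    spared∈C (suc (suc (suc zero))) = c₁∈C

    strategy : HunterStrategy G
    strategy = record { len = 4 ; shot = λ i → C - spared i ; nonempty = C-minus-nonempty two ∘ spared }

    uses : UsesAtMost G strategy (pred k)
    uses i = ℕₚ.<⇒≤pred (x∈p⇒∣p-x∣<∣p∣ (spared∈C i))

    -- Two consecutive positions are neither both in I nor both c₂, so the
    -- walk passes through a vertex of I between c₁ and c₂.
    no-escape : ∀ {r₀ r₁ r₂ r₃} → Adj G r₀ r₁ → Adj G r₁ r₂ → Adj G r₂ r₃ →
      r₀ ∈ I ⊎ r₀ ≡ c₁ → r₁ ∈ I ⊎ r₁ ≡ c₂ → r₂ ∈ I ⊎ r₂ ≡ c₂ → r₃ ∈ I ⊎ r₃ ≡ c₁ → ⊥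
    no-escape r₀~r₁ _ _ (inj₁ r₀∈I) (inj₁ r₁∈I) _ _ = independent r₀∈I r₁∈I r₀~r₁
    no-escape _ r₁~r₂ _ (inj₂ refl) (inj₁ r₁∈I) (inj₁ r₂∈I) _ = independent r₁∈I r₂∈I r₁~r₂
    no-escape r₀~r₁ r₁~r₂ _ (inj₂ refl) (inj₁ r₁∈I) (inj₂ refl) _ = unlinked _ r₁∈I (sym G r₀~r₁ , r₁~r₂)
    no-escape _ r₁~r₂ _ _ (inj₂ refl) (inj₂ refl) _ = irrefl G r₁~r₂
    no-escape _ _ r₂~r₃ _ (inj₂ refl) (inj₁ r₂∈I) (inj₁ r₃∈I) = independent r₂∈I r₃∈I r₂~r₃
    no-escape _ r₁~r₂ r₂~r₃ _ (inj₂ refl) (inj₁ r₂∈I) (inj₂ refl) = unlinked _ r₂∈I (r₂~r₃ , sym G r₁~r₂)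

    wins : IsWinning G strategy
    wins r steps with Finₚ.any? (λ j → r (inject₁ j) ∈? (C - spared j))
    ... | yes caught = caught
    ... | no uncaught =
      ⊥-elim (no-escape (steps (# 0)) (steps (# 1)) (steps (# 2)) (dodges (# 0)) (dodges (# 1)) (dodges (# 2)) (dodges (# 3)))
      where
      dodges : ∀ j → r (inject₁ j) ∈ I ⊎ r (inject₁ j) ≡ spared j
      dodges j with C∪I (r (inject₁ j)) | r (inject₁ j) Finₚ.≟ spared j
      ... | inj₂ rⱼ∈I | _ = inj₁ rⱼ∈I
      ... | inj₁ _ | yes rⱼ≡spared = inj₂ rⱼ≡spared
      ... | inj₁ rⱼ∈C | no rⱼ≢spared = contradiction (j , x∈p∧x≢y⇒x∈p-y rⱼ∈C rⱼ≢spared) uncaught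

  narrowStrategy : HasUnlinkedPair → TwoInC → HasWinningWith G (pred k)
  narrowStrategy (_ , _ , c₁∈C , c₂∈C , unlinked) two = strategy , wins , uses
    where open Sweep c₁∈C c₂∈C unlinked two

  module Rabbit {m} (m<k : m ℕ.< k) (linked : pred k ℕ.≤ m → ¬ HasUnlinkedPair) where

    unshot-clique-vertex : ∀ {X} → ∣ X ∣ ℕ.≤ m → ∃ λ c → c ∈ C × c ∉ X
    unshot-clique-vertex {X} ∣X∣≤m with C ⊆? X
    ... | yes C⊆X = contradiction (ℕₚ.≤-trans (p⊆q⇒∣p∣≤∣q∣ C⊆X) ∣X∣≤m) (ℕₚ.<⇒≱ m<k)
    ... | no C⊈X = ⊈-witness C⊈X

    -- If no other clique vertex is unshot, exactly C − r is shot: then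
    -- pred k ≤ m, so every pair is linked, and no vertex of I is shot.
    next-move : ∀ {r X} → r ∈ C → ∣ X ∣ ℕ.≤ m →
      (∃ λ c → c ∈ C × c ≢ r × c ∉ X) ⊎
      (∀ {c} → c ∈ C → ∃ λ w → w ∈ I × w ∉ X × Adj G r w × Adj G w c)
    next-move {r} {X} r∈C ∣X∣≤m with (C - r) ⊆? X
    ... | no C-r⊈X =
      let (c , c∈C-r , c∉X) = ⊈-witness C-r⊈X in inj₁ (c , p─q⊆p C ⁅ r ⁆ c∈C-r , x∈p-y⇒x≢y c∈C-r , c∉X)
    ... | yes C-r⊆X = inj₂ λ c∈C →
      let (w , w∈I , r~w , w~c) = common-I-neighbour (linked pred-k≤m) r∈C c∈C in w , w∈I , I∉X w∈I , r~w , w~c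
      where
      pred-k≤m : pred k ℕ.≤ m
      pred-k≤m = ℕₚ.≤-trans (ℕₚ.pred-mono-≤ (∣p∣≤1+∣p-x∣ C r)) (ℕₚ.≤-trans (p⊆q⇒∣p∣≤∣q∣ C-r⊆X) ∣X∣≤m)
      I∉X : ∀ {w} → w ∈ I → w ∉ X
      I∉X w∈I w∈X = ℕₚ.<⇒≱ m<k (ℕₚ.≤-trans (∣p∣≤1+∣p-x∣ C r) (ℕₚ.≤-trans C-r<X ∣X∣≤m))
        where
        C-r<X : ∣ C - r ∣ ℕ.< ∣ X ∣
        C-r<X = p⊂q⇒∣p∣<∣q∣ (C-r⊆X , _ , w∈X , λ w∈C-r → ∈I⇒∉C w∈I (p─q⊆p C ⁅ r ⁆ w∈C-r))

    module _ (S : HunterStrategy G) (uses : UsesAtMost G S m) where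

      survives : ∀ d t {r} → r ∈ C → r ∉ shotAt S t → EscapesFrom S d t r
      survives zero t {r} _ _ = (λ _ → r) , refl , (λ _ ()) , (λ _ ())
      survives (suc d) t {r} r∈C r∉ with next-move r∈C (∣shotAt∣≤ S uses (suc t))
      ... | inj₁ (c , c∈C , c≢r , c∉) =
        escapes-step S (clique r∈C c∈C (c≢r ∘ ≡.sym)) r∉ (survives d (suc t) c∈C c∉)
      ... | inj₂ via-I with unshot-clique-vertex (∣shotAt∣≤ S uses (suc (suc t)))
      ...   | c , c∈C , c∉ with via-I c∈C
      ...     | w , _ , w∉ , r~w , w~c =
        escapes-weaken S (escapes-step S r~w r∉ (escapes-step S w~c w∉ (survives d (suc (suc t)) c∈C c∉)))

      rabbit-wins : ¬ IsWinning G S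
      rabbit-wins with unshot-clique-vertex (∣shotAt∣≤ S uses 0)
      ... | r , r∈C , r∉ = escapes⇒¬winning S (survives _ 0 r∈C r∉)

    no-winning-strategy : ¬ HasWinningWith G m
    no-winning-strategy (S , wins , uses) = rabbit-wins S uses wins

  pathwidth-unlinked : HasUnlinkedPair → ∀ {c₀ p} → c₀ ∈ C → IsPathwidth G p → p ≡ pred k
  pathwidth-unlinked unlinked c₀∈C (has-p , least) =
    ℕₚ.≤-antisym (least _ (narrowDecomposition unlinked)) (pred-k≤width c₀∈C has-p)

  pathwidth-linked : ¬ HasUnlinkedPair → ∀ {c₀ p} → c₀ ∈ C → IsPathwidth G p → p ≡ k
  pathwidth-linked linked c₀∈C ((D , width) , least) =
    ℕₚ.≤-antisym (least _ wideDecomposition)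
      (ℕₚ.≮⇒≥ λ p<k → linked (narrow⇒unlinked c₀∈C D λ i → ℕₚ.≤-trans (width i) p<k))

  hunters-unlinked : HasUnlinkedPair → Connected G → ∀ {h} → IsHunterNumber G h → h ≡ pred k
  hunters-unlinked unlinked connected (trivial , nontrivial) with n G ℕ.≟ 1
  ... | yes n≡1 = ≡.trans (trivial n≡1) (≡.sym (ℕₚ.n≤0⇒n≡0 (ℕₚ.pred-mono-≤ (subst (k ℕ.≤_) n≡1 (∣p∣≤n C)))))
  ... | no n≢1 =
    let (has-h , least) = nontrivial n≢1
        (_ , _ , x~y) = connected⇒edge {G} connected n≢1
    in ℕₚ.≤-antisym (least _ (narrowStrategy unlinked (edge⇒two-in-C x~y)))
         (ℕₚ.≮⇒≥ λ h<pred-k → Rabbit.no-winning-strategy (ℕₚ.<-≤-trans h<pred-k ℕₚ.pred[n]≤n)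
           (λ pred-k≤h → contradiction pred-k≤h (ℕₚ.<⇒≱ h<pred-k)) has-h)

  hunters-linked : ¬ HasUnlinkedPair → ∀ {c₀ h} → c₀ ∈ C → IsHunterNumber G h → h ≡ k
  hunters-linked linked c₀∈C (_ , nontrivial) =
    let (_ , _ , c₀~w , _) = common-I-neighbour linked c₀∈C c₀∈C
        (has-h , least) = nontrivial (edge⇒n≢1 {G} c₀~w)
    in ℕₚ.≤-antisym (least _ (wideStrategy c₀∈C))
         (ℕₚ.≮⇒≥ λ h<k → Rabbit.no-winning-strategy h<k (λ _ → linked) has-h)

  hunters≡pathwidth : Connected G → ∀ {h p} → IsHunterNumber G h → IsPathwidth G p → h ≡ p
  hunters≡pathwidth connected isH isP with C-nonempty (proj₁ connected) | unlinked?
  ... | _ , c₀∈C | yes unlinked =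
    ≡.trans (hunters-unlinked unlinked connected isH) (≡.sym (pathwidth-unlinked unlinked c₀∈C isP))
  ... | _ , c₀∈C | no linked =
    ≡.trans (hunters-linked linked c₀∈C isH) (≡.sym (pathwidth-linked linked c₀∈C isP))

-- Adjacency is not assumed decidable, but h ≡ p is, so decidability of
-- adjacency may be assumed under a double negation.
corollary4p4 : (G : Graph) → Connected G → IsSplitGraph G →
    (h p : ℕ) → IsHunterNumber G h → IsPathwidth G p → h ≡ p
corollary4p4 G connected (C , I , C∪I , C∩I , (clique , maximal) , independent) h p isH isP =
  decidable-stable (h ℕ.≟ p) λ h≢p → ¬¬-decidable (Adj G) λ adj? →
    h≢p (SplitGraph.hunters≡pathwidth G adj? C I C∪I C∩I clique maximal independent connected isH isP)
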